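{- For every instance of DDP-NC with charging stations and every $\ell$ with $1\le\ell\le r+1$, $OPT_\ell\le OPT_{NC}$, where $OPT_\ell$ is the minimum number of blocks in a partition of $\mathcal I_\ell$ into blocks.
   Context: Model: $n$ deliveries with closed, pairwise disjoint delivery time intervals $I_j=[t_j^L,t_j^R]$ and costs $cost(I_j)\in(0,B]$, $B>0$ the battery capacity of identical drones. $r$ charging stations with waiting intervals $I_\ell^c=[t_\ell^A,t_\ell^D]$, $t_1^A<t_1^D<\dots<t_r^A<t_r^D$; no delivery interval is contained in a waiting interval and none intersects two waiting intervals. A drone may charge at station $\ell$ during a subinterval $[t',t'']\subseteq I_\ell^c$, its battery going from $rem$ to $Ch_\ell([t',t''],rem)\le B$ with $Ch_\ell(I_\ell^c,rem)=B$; it cannot serve deliveries intersecting $[t',t'']$. A drone starts with battery $B$; a feasible assignment is a set of delivery intervals and charging subintervals, pairwise disjoint, such that in time order each delivery's cost is at most the remaining battery when taken. $OPT_{NC}$ is the minimum number of drones such that every delivery is assigned to exactly one drone with all assignments feasible. $\mathcal I_1=\{I_j: t_j^L<t_1^A\}$, $\mathcal I_\ell=\{I_j: t_{\ell-1}^A\le t_j^L<t_\ell^A\}$ for $2\le\ell\le r$, $\mathcal I_{r+1}=\{I_j: t_j^L\ge t_r^A\}$. A block is a set of delivery intervals of total cost at most $B$.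
   Formalization: The delivery and waiting times, the costs, the battery capacity B and the arguments and values of the charging functions are rational rather than real. -}

module Defs where

open import Data.Nat using (ℕ; zero; suc)
open import Data.Fin using (Fin; zero; suc) renaming (_<_ to _<ᶠ_)
open import Data.Maybe using (Maybe; just; nothing)
import Data.Maybe as Maybe
open import Data.Bool using (Bool; true; false; _∧_; if_then_else_)
open import Data.List using (List; []; _∷_; foldr)
open import Data.List.Base using (allFin)
open import Data.List.Relation.Unary.Linked using (Linked)
open import Data.Product using (_×_; Σ; _,_)
open import Data.Sum using (_⊎_)
open import Data.Unit using (⊤)
open import Data.Empty using (⊥)
open import Relation.Nullary using (¬_; Dec; yes; no; does)
open import Relation.Binary.PropositionalEquality using (_≡_; _≢_)
open import Data.Rational using (ℚ; 0ℚ; _+_; _-_; _≤_; _<_)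
open import Data.Rational.Properties using (_≤?_; _<?_)
import Data.Fin.Properties as FinP

-- Deliveries are indexed by Fin n, charging stations by Fin r
-- (station 1..r of the paper = 0..r-1 here).

record Instance : Set where
  field
    B      : ℚ
    B-pos  : 0ℚ < B
    n      : ℕ
    tL tR  : Fin n → ℚ
    cost   : Fin n → ℚ
    r      : ℕ
    tA tD  : Fin r → ℚ
    -- Ch ℓ t' t'' rem : battery after charging at station ℓ during [t',t'']
    Ch     : Fin r → ℚ → ℚ → ℚ → ℚ

    tL≤tR        : ∀ j → tL j ≤ tR j
    deliv-disj   : ∀ i j → i ≢ j → (tR i < tL j) ⊎ (tR j < tL i)
    cost-pos     : ∀ j → 0ℚ < cost j
    cost≤B       : ∀ j → cost j ≤ B
    tA<tD        : ∀ ℓ → tA ℓ < tD ℓ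
    stations-ord : ∀ ℓ ℓ' → ℓ <ᶠ ℓ' → tD ℓ < tA ℓ'
    Ch≤B         : ∀ ℓ t' t'' rem → tA ℓ ≤ t' → t' ≤ t'' → t'' ≤ tD ℓ →
                   Ch ℓ t' t'' rem ≤ B
    Ch-full      : ∀ ℓ rem → Ch ℓ (tA ℓ) (tD ℓ) rem ≡ B
    not-contained : ∀ j ℓ → ¬ (tA ℓ ≤ tL j × tR j ≤ tD ℓ)
    not-two       : ∀ j ℓ ℓ' → ℓ ≢ ℓ' →
                    ¬ ((tL j ≤ tD ℓ × tA ℓ ≤ tR j) × (tL j ≤ tD ℓ' × tA ℓ' ≤ tR j))

module _ (I : Instance) where
  open Instance I

  -- an element of a drone's assignment: a delivery, or a charging
  -- subinterval [t',t''] at station ℓ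
  data Event : Set where
    deliver : Fin n → Event
    charge  : Fin r → ℚ → ℚ → Event

  left right : Event → ℚ
  left  (deliver j)       = tL j
  left  (charge ℓ t' t'') = t'
  right (deliver j)       = tR j
  right (charge ℓ t' t'') = t''

  Before : Event → Event → Set
  Before e e' = right e < left e'

  BatteryOK : ℚ → List Event → Set
  BatteryOK rem [] = ⊤
  BatteryOK rem (deliver j ∷ es) = cost j ≤ rem × BatteryOK (rem - cost j) es
  BatteryOK rem (charge ℓ t' t'' ∷ es) =
    (tA ℓ ≤ t' × t' ≤ t'' × t'' ≤ tD ℓ) × BatteryOK (Ch ℓ t' t'' rem) es

  FeasibleAssignment : List Event → Set
  FeasibleAssignment es = Linked Before es × BatteryOK B es

  data _∈ᵉ_ (j : Fin n) : List Event → Set where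
    here  : ∀ {es} → j ∈ᵉ (deliver j ∷ es)
    there : ∀ {e es} → j ∈ᵉ es → j ∈ᵉ (e ∷ es)

  Solvable : ℕ → Set
  Solvable k =
    Σ (Fin k → List Event) λ sched →
      (∀ d → FeasibleAssignment (sched d)) ×
      (∀ j → Σ (Fin k) λ d → j ∈ᵉ sched d × (∀ d' → j ∈ᵉ sched d' → d' ≡ d))

  -- The classes 𝓘_ℓ, ℓ = 1..r+1 of the paper = Fin (suc r) here (0-based)

  -- index of the station whose arrival time bounds class ℓ from above
  upperIdx : ∀ {m} → Fin (suc m) → Maybe (Fin m)
  upperIdx {zero}  zero    = nothing
  upperIdx {suc m} zero    = just zero
  upperIdx {suc m} (suc i) = Maybe.map suc (upperIdx i)

  LowerOK : Fin (suc r) → Fin n → Set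
  LowerOK zero    j = ⊤
  LowerOK (suc i) j = tA i ≤ tL j

  UpperOK : Maybe (Fin r) → Fin n → Set
  UpperOK nothing  j = ⊤
  UpperOK (just i) j = tL j < tA i

  InClass : Fin (suc r) → Fin n → Set
  InClass ℓ j = LowerOK ℓ j × UpperOK (upperIdx ℓ) j

  lower? : ∀ ℓ j → Dec (LowerOK ℓ j)
  lower? zero    j = yes _
  lower? (suc i) j = tA i ≤? tL j

  upper? : ∀ m j → Dec (UpperOK m j)
  upper? nothing  j = yes _
  upper? (just i) j = tL j <? tA i

  inClass? : ∀ ℓ j → Dec (InClass ℓ j)
  inClass? ℓ j with lower? ℓ j | upper? (upperIdx ℓ) j
  ... | yes p | yes q = yes (p , q)
  ... | no ¬p | _     = no λ { (p , q) → ¬p p }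
  ... | yes _ | no ¬q = no λ { (p , q) → ¬q q }

  -- Partitions of a class into k blocks: β assigns to every member of
  -- 𝓘_ℓ a block in Fin k (values on non-members are irrelevant);
  -- each block has total cost at most B.

  blockCost : Fin (suc r) → ∀ {k} → (Fin n → Fin k) → Fin k → ℚ
  blockCost ℓ β b =
    foldr (λ j acc → (if does (inClass? ℓ j) ∧ does (β j FinP.≟ b)
                      then cost j else 0ℚ) + acc)
          0ℚ (allFin n)

  Partitionable : Fin (suc r) → ℕ → Set
  Partitionable ℓ k =
    Σ (Fin n → Fin k) λ β → ∀ b → blockCost ℓ β b ≤ B

IsMinimum : (ℕ → Set) → ℕ → Set
IsMinimum P m = P m × (∀ k → P k → Data.Nat._≤_ m k)
  where import Data.Nat

IsOPT-NC : (I : Instance) → ℕ → Set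
IsOPT-NC I = IsMinimum (Solvable I)

IsOPT-ℓ : (I : Instance) → Fin (suc (Instance.r I)) → ℕ → Set
IsOPT-ℓ I ℓ = IsMinimum (Partitionable I ℓ)

-- A drone cannot recharge between two deliveries of the same class 𝓘_ℓ: a charging interval
-- after a class-ℓ delivery lies at a station of index ≥ ℓ - 1, one before a class-ℓ delivery at
-- a station of index < ℓ, so it would be station ℓ - 1, whose waiting interval would then contain
-- the first delivery. Hence from its first class-ℓ delivery on, a drone's battery only decreases
-- until its last one, and the class-ℓ deliveries of every drone form a block. Grouping 𝓘_ℓ by
-- drones in an optimal solution thus partitions it into OPT_NC blocks.
module Submission where

open import Defs
open import Data.Nat using (ℕ; suc)
open import Data.Fin using (Fin; zero; suc; toℕ)
import Data.Nat as ℕ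
import Data.Nat.Properties as ℕ
import Data.Fin as Fin
open import Data.Fin.Properties using (_≟_; <-cmp; toℕ<n; toℕ-injective)
open import Data.Rational using (ℚ; 0ℚ; _+_; _-_; _≤_; _<_)
open import Data.Rational.Properties
  using (≤-refl; ≤-reflexive; ≤-trans; <-trans; <-irrefl; <-asym; <⇒≤; ≤-<-trans; <-≤-trans;
         +-mono-≤; +-monoˡ-≤; +-monoʳ-≤; +-identityˡ; +-identityʳ; +-inverseʳ; neg-antimono-≤;
         +-0-commutativeMonoid)
open import Data.Rational.Solver using (module +-*-Solver)
open import Algebra.Properties.CommutativeMonoid.Sum +-0-commutativeMonoid
  using (sum-syntax; ∑-distrib-+; sum-replicate-zero)
open import Data.Bool using (true; false; _∧_; if_then_else_)
open import Data.List using (List; []; _∷_; foldr; tabulate)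
open import Data.List.Membership.Propositional using (_∈_)
open import Data.List.Relation.Unary.Any using (here; there)
open import Data.List.Relation.Unary.Linked as Linked using (Linked; [-]; _∷_)
open import Data.Maybe using (Maybe; just; nothing)
open import Data.Product using (_×_; _,_; proj₁; proj₂)
open import Data.Sum using (_⊎_; inj₁; inj₂)
open import Data.Unit using (⊤; tt)
open import Data.Empty using (⊥-elim)
open import Relation.Binary.Definitions using (tri<; tri≈; tri>)
open import Relation.Binary.PropositionalEquality using (_≡_; refl; sym; cong; cong₂; subst; module ≡-Reasoning)
open import Relation.Nullary using (¬_; yes; no; does)
open import Relation.Nullary.Decidable using (dec-true)

≤-sub⇒+≤ : ∀ {p q x} → x ≤ p - q → q + x ≤ p
≤-sub⇒+≤ {p} {q} x≤p-q = subst (q + _ ≤_) (q+[p-q]≡p p q) (+-monoʳ-≤ q x≤p-q)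
  where
  open +-*-Solver
  q+[p-q]≡p : ∀ p q → q + (p - q) ≡ p
  q+[p-q]≡p = solve 2 (λ p q → q :+ (p :- q) := p) refl

0≤p-q : ∀ {p q} → q ≤ p → 0ℚ ≤ p - q
0≤p-q {p} {q} q≤p = subst (_≤ p - q) (+-inverseʳ q) (+-monoˡ-≤ _ q≤p)

p-q≤p : ∀ {p q} → 0ℚ ≤ q → p - q ≤ p
p-q≤p {p} 0≤q = subst (p - _ ≤_) (+-identityʳ p) (+-monoʳ-≤ p (neg-antimono-≤ 0≤q))

x≤y⇒0+x≤y : ∀ {x y} → x ≤ y → 0ℚ + x ≤ y
x≤y⇒0+x≤y {x} = subst (_≤ _) (sym (+-identityˡ x))

∑ᴸ : {A : Set} → List A → (A → ℚ) → ℚ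
∑ᴸ xs f = foldr (λ x acc → f x + acc) 0ℚ xs

∑ᴸ-tabulate : ∀ {A : Set} {m} (f : Fin m → A) (g : A → ℚ) → ∑ᴸ (tabulate f) g ≡ ∑[ i < m ] g (f i)
∑ᴸ-tabulate {m = ℕ.zero} f g = refl
∑ᴸ-tabulate {m = suc m}  f g = cong (g (f zero) +_) (∑ᴸ-tabulate (λ i → f (suc i)) g)

∑-mono-≤ : ∀ {m} {f g : Fin m → ℚ} → (∀ i → f i ≤ g i) → ∑[ i < m ] f i ≤ ∑[ i < m ] g i
∑-mono-≤ {ℕ.zero} f≤g = ≤-refl
∑-mono-≤ {suc m}  f≤g = +-mono-≤ (f≤g zero) (∑-mono-≤ (λ i → f≤g (suc i)))

∑-δ : ∀ {m} (i : Fin m) (x : Fin m → ℚ) → ∑[ j < m ] (if does (i ≟ j) then x j else 0ℚ) ≡ x i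
∑-δ {suc m} zero x = begin
  x zero + ∑[ j < m ] 0ℚ  ≡⟨ cong (x zero +_) (sum-replicate-zero m) ⟩
  x zero + 0ℚ             ≡⟨ +-identityʳ (x zero) ⟩
  x zero                  ∎
  where open ≡-Reasoning
∑-δ {suc m} (suc i) x = begin
  0ℚ + ∑[ j < m ] (if does (i ≟ j) then x (suc j) else 0ℚ)  ≡⟨ +-identityˡ _ ⟩
  ∑[ j < m ] (if does (i ≟ j) then x (suc j) else 0ℚ)       ≡⟨ ∑-δ i (λ j → x (suc j)) ⟩
  x (suc i)                                                 ∎
  where open ≡-Reasoning

if-nonneg : ∀ b {x} → 0ℚ ≤ x → 0ℚ ≤ (if b then x else 0ℚ)
if-nonneg true  0≤x = 0≤x
if-nonneg false 0≤x = ≤-refl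

module _ {m} (v : Fin m → ℚ) where

  occurrenceWeight : List (Fin m) → Fin m → ℚ
  occurrenceWeight xs j = ∑ᴸ xs (λ i → if does (i ≟ j) then v j else 0ℚ)

  ∑-occurrenceWeight : ∀ xs → ∑[ j < m ] occurrenceWeight xs j ≡ ∑ᴸ xs v
  ∑-occurrenceWeight []       = sum-replicate-zero m
  ∑-occurrenceWeight (i ∷ xs) = begin
    ∑[ j < m ] ((if does (i ≟ j) then v j else 0ℚ) + occurrenceWeight xs j)
      ≡⟨ ∑-distrib-+ (λ j → if does (i ≟ j) then v j else 0ℚ) (occurrenceWeight xs) ⟩
    ∑[ j < m ] (if does (i ≟ j) then v j else 0ℚ) + ∑[ j < m ] occurrenceWeight xs j
      ≡⟨ cong₂ _+_ (∑-δ i v) (∑-occurrenceWeight xs) ⟩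
    v i + ∑ᴸ xs v
      ∎
    where open ≡-Reasoning

  module _ (v≥0 : ∀ j → 0ℚ ≤ v j) where

    occurrenceWeight-nonneg : ∀ xs j → 0ℚ ≤ occurrenceWeight xs j
    occurrenceWeight-nonneg []       j = ≤-refl
    occurrenceWeight-nonneg (i ∷ xs) j =
      +-mono-≤ (if-nonneg (does (i ≟ j)) (v≥0 j)) (occurrenceWeight-nonneg xs j)

    ∈⇒≤-occurrenceWeight : ∀ {j xs} → j ∈ xs → v j ≤ occurrenceWeight xs j
    ∈⇒≤-occurrenceWeight {j} {.j ∷ xs} (here refl) =
      subst (_≤ occurrenceWeight (j ∷ xs) j) (+-identityʳ (v j))
        (+-mono-≤ (≤-reflexive (cong (λ b → if b then v j else 0ℚ) (sym (dec-true (j ≟ j) refl))))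
                  (occurrenceWeight-nonneg xs j))
    ∈⇒≤-occurrenceWeight {j} {i ∷ xs} (there j∈xs) =
      subst (_≤ occurrenceWeight (i ∷ xs) j) (+-identityˡ (v j))
        (+-mono-≤ (if-nonneg (does (i ≟ j)) (v≥0 j)) (∈⇒≤-occurrenceWeight j∈xs))

    ∑-≤-∑ᴸ : ∀ (u : Fin m → ℚ) xs → (∀ j → (j ∈ xs × u j ≤ v j) ⊎ u j ≤ 0ℚ) →
             ∑[ j < m ] u j ≤ ∑ᴸ xs v
    ∑-≤-∑ᴸ u xs u-bounded =
      subst (_ ≤_) (∑-occurrenceWeight xs) (∑-mono-≤ u≤occurrenceWeight)
      where
      u≤occurrenceWeight : ∀ j → u j ≤ occurrenceWeight xs j
      u≤occurrenceWeight j with u-bounded j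
      ... | inj₁ (j∈xs , uj≤vj) = ≤-trans uj≤vj (∈⇒≤-occurrenceWeight j∈xs)
      ... | inj₂ uj≤0           = ≤-trans uj≤0 (occurrenceWeight-nonneg xs j)

module _ (I : Instance) where
  open Instance I

  tA<tA⇒< : ∀ {s u} → tA s < tA u → s Fin.< u
  tA<tA⇒< {s} {u} tAs<tAu with <-cmp s u
  ... | tri< s<u _ _ = s<u
  ... | tri≈ _ refl _ = ⊥-elim (<-irrefl refl tAs<tAu)
  ... | tri> _ _ u<s = ⊥-elim (<-asym tAs<tAu (<-trans (tA<tD u) (stations-ord u s u<s)))

  tA<tD⇒≤ : ∀ {i s} → tA i < tD s → i Fin.≤ s
  tA<tD⇒≤ {i} {s} tAi<tDs with <-cmp s i
  ... | tri< s<i _ _ = ⊥-elim (<-asym tAi<tDs (stations-ord s i s<i))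
  ... | tri≈ _ refl _ = ℕ.≤-refl
  ... | tri> _ _ i<s = ℕ.<⇒≤ i<s

  data UpperIdxView {m} (x : Fin (suc m)) : Maybe (Fin m) → Set where
    station : (u : Fin m) → toℕ u ≡ toℕ x → UpperIdxView x (just u)
    last    : toℕ x ≡ m → UpperIdxView x nothing

  upperIdxView : ∀ {m} (x : Fin (suc m)) → UpperIdxView x (upperIdx I x)
  upperIdxView {ℕ.zero} zero    = last refl
  upperIdxView {suc m}  zero    = station zero refl
  upperIdxView {suc m}  (suc x) with upperIdx I x | upperIdxView x
  ... | just u  | station .u u≡x = station (suc u) (cong suc u≡x)
  ... | nothing | last x≡m       = last (cong suc x≡m)

  classDelivery-outlasts-earlier-station :
    ∀ x {s d} → LowerOK I x d → toℕ s ℕ.< toℕ x → ¬ tR d < tD s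
  classDelivery-outlasts-earlier-station (suc i) {s} {d} tAi≤tLd (ℕ.s≤s s≤i) tRd<tDs
    with toℕ-injective (ℕ.≤-antisym s≤i (tA<tD⇒≤ (≤-<-trans tAi≤tLd (≤-<-trans (tL≤tR d) tRd<tDs))))
  ... | refl = not-contained d s (tAi≤tLd , <⇒≤ tRd<tDs)

  deliveries : List (Event I) → List (Fin n)
  deliveries []                   = []
  deliveries (deliver j ∷ es)     = j ∷ deliveries es
  deliveries (charge _ _ _ ∷ es)  = deliveries es

  ∈ᵉ⇒∈-deliveries : ∀ {j es} → _∈ᵉ_ I j es → j ∈ deliveries es
  ∈ᵉ⇒∈-deliveries here                               = here refl
  ∈ᵉ⇒∈-deliveries {es = deliver _ ∷ _}     (there p) = there (∈ᵉ⇒∈-deliveries p)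
  ∈ᵉ⇒∈-deliveries {es = charge _ _ _ ∷ _}  (there p) = ∈ᵉ⇒∈-deliveries p

  StartsAfter : ℚ → List (Event I) → Set
  StartsAfter T []      = ⊤
  StartsAfter T (e ∷ _) = T < left I e

  startsAfter-tail : ∀ {e es} → Linked (Before I) (e ∷ es) → StartsAfter (right I e) es
  startsAfter-tail [-]     = tt
  startsAfter-tail (h ∷ _) = h

  module _ (ℓ : Fin (suc r)) where

    station-before-class : ∀ {s d} → InClass I ℓ d → tA s < tL d → toℕ s ℕ.< toℕ ℓ
    station-before-class {s} (_ , upper) tAs<tLd with upperIdx I ℓ | upperIdxView ℓ
    ... | just u  | station .u u≡ℓ = subst (toℕ s ℕ.<_) u≡ℓ (tA<tA⇒< (<-trans tAs<tLd upper))
    ... | nothing | last ℓ≡r       = subst (toℕ s ℕ.<_) (sym ℓ≡r) (toℕ<n s)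

    no-charge-between-class-deliveries :
      ∀ {d₁ d₂ s t′ t″} → InClass I ℓ d₁ → InClass I ℓ d₂ →
      tR d₁ < t′ → tA s ≤ t′ → t′ ≤ t″ → t″ ≤ tD s → ¬ t″ < tL d₂
    no-charge-between-class-deliveries (lower₁ , _) class₂ tR₁<t′ tA≤t′ t′≤t″ t″≤tD t″<tL₂ =
      classDelivery-outlasts-earlier-station ℓ lower₁
        (station-before-class class₂ (≤-<-trans (≤-trans tA≤t′ t′≤t″) t″<tL₂))
        (<-≤-trans tR₁<t′ (≤-trans t′≤t″ t″≤tD))

    classWeight : Fin n → ℚ
    classWeight j = if does (inClass? I ℓ j) then cost j else 0ℚ

    classWeight-nonneg : ∀ j → 0ℚ ≤ classWeight j
    classWeight-nonneg j = if-nonneg (does (inClass? I ℓ j)) (<⇒≤ (cost-pos j))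

    classWeight+≤ : ∀ j {rem x} → x ≤ rem - cost j → classWeight j + x ≤ rem
    classWeight+≤ j x≤rem-cj with inClass? I ℓ j
    ... | yes _ = ≤-sub⇒+≤ x≤rem-cj
    ... | no _  = x≤y⇒0+x≤y (≤-trans x≤rem-cj (p-q≤p (<⇒≤ (cost-pos j))))

    classCost : List (Event I) → ℚ
    classCost es = ∑ᴸ (deliveries es) classWeight

    NoClassAfter : ℚ → Set
    NoClassAfter T = ∀ j → InClass I ℓ j → ¬ T < tL j

    noClassAfter-mono : ∀ {T T′} → T ≤ T′ → NoClassAfter T → NoClassAfter T′
    noClassAfter-mono T≤T′ none j class T′<tLj = none j class (≤-<-trans T≤T′ T′<tLj)

    classCost-without-class : ∀ {T rem es} → NoClassAfter T → StartsAfter T es →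
      Linked (Before I) es → BatteryOK I rem es → classCost es ≡ 0ℚ
    classCost-without-class {es = []} _ _ _ _ = refl
    classCost-without-class {T} {es = deliver j ∷ es} none T<tLj linked (_ , battery)
      with inClass? I ℓ j
    ... | yes class = ⊥-elim (none j class T<tLj)
    ... | no _      = begin
      0ℚ + classCost es  ≡⟨ +-identityˡ _ ⟩
      classCost es       ≡⟨ classCost-without-class
                              (noClassAfter-mono (<⇒≤ (<-≤-trans T<tLj (tL≤tR j))) none)
                              (startsAfter-tail linked) (Linked.tail linked) battery ⟩
      0ℚ                 ∎
      where open ≡-Reasoning
    classCost-without-class {es = charge _ _ _ ∷ es} none T<t′ linked ((_ , t′≤t″ , _) , battery) =
      classCost-without-class (noClassAfter-mono (<⇒≤ (<-≤-trans T<t′ t′≤t″)) none)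
        (startsAfter-tail linked) (Linked.tail linked) battery

    classCost-after-class : ∀ {d T rem es} → InClass I ℓ d → tR d ≤ T → 0ℚ ≤ rem →
      StartsAfter T es → Linked (Before I) es → BatteryOK I rem es → classCost es ≤ rem
    classCost-after-class {es = []} _ _ 0≤rem _ _ _ = 0≤rem
    classCost-after-class {es = deliver j ∷ es} class tRd≤T 0≤rem T<tLj linked (cj≤rem , battery) =
      classWeight+≤ j (classCost-after-class class (≤-trans tRd≤T (<⇒≤ (<-≤-trans T<tLj (tL≤tR j))))
        (0≤p-q cj≤rem) (startsAfter-tail linked) (Linked.tail linked) battery)
    classCost-after-class {es = charge s t′ t″ ∷ es} class tRd≤T 0≤rem T<t′ linked
      ((tA≤t′ , t′≤t″ , t″≤tD) , battery) =
      ≤-trans (≤-reflexive (classCost-without-class none (startsAfter-tail linked) (Linked.tail linked) battery))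
        0≤rem
      where
      none : NoClassAfter t″
      none j class′ = no-charge-between-class-deliveries class class′
        (≤-<-trans tRd≤T T<t′) tA≤t′ t′≤t″ t″≤tD

    classCost-≤-B : ∀ {rem es} → rem ≤ B → Linked (Before I) es → BatteryOK I rem es → classCost es ≤ B
    classCost-≤-B {es = []} _ _ _ = <⇒≤ B-pos
    classCost-≤-B {rem} {deliver j ∷ es} rem≤B linked (cj≤rem , battery) with inClass? I ℓ j
    ... | yes class = ≤-trans (≤-sub⇒+≤ (classCost-after-class class ≤-refl (0≤p-q cj≤rem)
                        (startsAfter-tail linked) (Linked.tail linked) battery)) rem≤B
    ... | no _ = x≤y⇒0+x≤y (classCost-≤-B (≤-trans (p-q≤p (<⇒≤ (cost-pos j))) rem≤B)
                   (Linked.tail linked) battery)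
    classCost-≤-B {rem} {charge s t′ t″ ∷ es} _ linked ((tA≤t′ , t′≤t″ , t″≤tD) , battery) =
      classCost-≤-B (Ch≤B s t′ t″ rem tA≤t′ t′≤t″ t″≤tD) (Linked.tail linked) battery

    blockCost-≤-classCost : ∀ {k} (β : Fin n → Fin k) b es →
      (∀ j → InClass I ℓ j → β j ≡ b → _∈ᵉ_ I j es) → blockCost I ℓ β b ≤ classCost es
    blockCost-≤-classCost β b es served =
      subst (_≤ _) (sym (∑ᴸ-tabulate (λ j → j) blockTerm))
        (∑-≤-∑ᴸ classWeight classWeight-nonneg blockTerm (deliveries es) blockTerm-bounded)
      where
      blockTerm : Fin n → ℚ
      blockTerm j = if does (inClass? I ℓ j) ∧ does (β j ≟ b) then cost j else 0ℚ

      blockTerm-bounded : ∀ j → (j ∈ deliveries es × blockTerm j ≤ classWeight j) ⊎ blockTerm j ≤ 0ℚ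
      blockTerm-bounded j with inClass? I ℓ j | β j ≟ b
      ... | yes class | yes βj≡b = inj₁ (∈ᵉ⇒∈-deliveries (served j class βj≡b) , ≤-refl)
      ... | yes _     | no _     = inj₂ ≤-refl
      ... | no _      | _        = inj₂ ≤-refl

lemma4 : (I : Instance) (ℓ : Fin (suc (Instance.r I))) (optℓ optNC : ℕ) →
    IsOPT-ℓ I ℓ optℓ → IsOPT-NC I optNC → optℓ ℕ.≤ optNC
lemma4 I ℓ optℓ optNC (_ , optℓ-minimal) ((schedule , feasible , assigned) , _) =
  optℓ-minimal optNC (drone , blockCost-≤-B)
  where
  open Instance I using (n; B)

  drone : Fin n → Fin optNC
  drone j = proj₁ (assigned j)

  blockCost-≤-B : ∀ d → blockCost I ℓ drone d ≤ B
  blockCost-≤-B d = ≤-trans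
    (blockCost-≤-classCost I ℓ drone d (schedule d) λ { j _ refl → proj₁ (proj₂ (assigned j)) })
    (classCost-≤-B I ℓ ≤-refl (proj₁ (feasible d)) (proj₂ (feasible d)))
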